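{- For every trie $\mathcal T$ and every integer $k\ge 0$, the number $r$ of XBWT runs satisfies $r\le \mathcal H^{wc}_k(\mathcal T)+\sigma^{k+1}$.
   Context: A trie $\mathcal T=(V,E)$ is a rooted tree with $n$ nodes whose edges are labeled with characters of $\Sigma=\{1,\dots,\sigma\}$, totally ordered by $\prec$, such that the edges leaving any node carry pairwise distinct labels. $\pi(\hat u)$ denotes the parent of node $\hat u$, with the convention $\pi(\text{root})=\text{root}$. $\lambda(\hat u)$ is the label of the edge entering $\hat u$; for the root $\lambda=\#$, where $\#$ is the $\prec$-smallest character of $\Sigma$ and labels no edge. Every character of $\Sigma$ is $\lambda(\hat u)$ for some node. $out(\hat u)$ is the set of labels of edges leaving $\hat u$. Nodes are sorted co-lexicographically: $\hat u<\hat v$ iff the root-to-node label string $\lambda(\text{root})\cdots\lambda(\hat u)$ precedes $\lambda(\text{root})\cdots\lambda(\hat v)$ when strings are compared right-to-left with $\prec$; let $\hat u_1<\dots<\hat u_n$ be the sorted nodes. For $c\in\Sigma$ and $1\le i\le n$, $i$ is a $c$-run break if $c\in out(\hat u_i)$ and either $i=n$ or $c\notin out(\hat u_{i+1})$; $r$ is the total number of pairs $(i,c)$ such that $i$ is a $c$-run break. Contexts: $\pi_0[\hat u]=\varepsilon$, $\pi_1[\hat u]=\lambda(\hat u)$, and $\pi_k[\hat u]=\pi_{k-1}[\pi(\hat u)]\cdot\lambda(\hat u)$ for $k>1$. For a finite sequence $X=X_1,\dots,X_{n'}$ of subsets of $\Sigma$ with $n'_c=|\{i: c\in X_i\}|$,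 the zero-order worst-case entropy is $\mathcal H^{wc}(X)=\sum_{c\in\Sigma}\log_2\binom{n'}{n'_c}$ (and $0$ for the empty sequence). For $\rho\in\Sigma^k$, $cover(\rho)$ is the sequence of sets $out(\hat u_i)$ over all $i$ with $\pi_k[\hat u_i]=\rho$. The $k$-th order worst-case entropy is $\mathcal H^{wc}_k(\mathcal T)=\sum_{\rho\in\Sigma^k}\mathcal H^{wc}(cover(\rho))$. -}

module Defs where

open import Data.Nat using (ℕ; _≟_; zero; suc; _+_; _*_; _^_; _≤_)
open import Data.Nat.Combinatorics using (_C_)
open import Data.Fin as Fin using (Fin; toℕ)
open import Data.Fin.Properties using (any?; all?) renaming (_≟_ to _≟ᶠ_)
open import Data.Fin.Subset using (Subset; _∈_; _∉_)
open import Data.Fin.Subset.Properties using (_∈?_)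
open import Data.Vec as Vec using (Vec; []; _∷_; _∷ʳ_)
open import Data.Vec.Properties using (≡-dec)
open import Data.List as List using (List; length; filter; map; allFin; cartesianProduct)
open import Data.Nat.ListAction using (product)
open import Data.Product using (Σ; ∃; _×_; _,_; proj₁; proj₂)
open import Relation.Nullary using (¬_; Dec; does; yes; no)
open import Relation.Nullary.Decidable using (_×-dec_; _→-dec_; ¬?)
open import Relation.Binary.PropositionalEquality using (_≡_; _≢_)

anc : ∀ {n} → (Fin n → Fin n) → ℕ → Fin n → Fin n
anc f zero    u = u
anc f (suc j) u = anc f j (f u)

-- A trie with n nodes (Fin n) over the alphabet Σ = Fin σ,
-- where characters are ordered by Fin._<_ (so the ≺-smallest character is Fin.zero, i.e. #).
record Trie (σ n : ℕ) : Set where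
  field
    root   : Fin n
    parent : Fin n → Fin n
    label  : Fin n → Fin σ
    parent-root : parent root ≡ root
    rooted      : ∀ u → ∃ λ j → anc parent j u ≡ root
    root-label  : toℕ (label root) ≡ 0
    edge-label  : ∀ u → u ≢ root → label u ≢ label root
    label-onto  : ∀ (c : Fin σ) → ∃ λ u → label u ≡ c
    siblings-distinct : ∀ u v → u ≢ root → v ≢ root → parent u ≡ parent v →
                        label u ≡ label v → u ≡ v

module _ {σ n : ℕ} (T : Trie σ n) where
  open Trie T

  OutRel : Fin n → Fin σ → Set
  OutRel u c = ∃ λ v → (¬ (v ≡ root)) × (parent v ≡ u) × (label v ≡ c)

  outRel? : ∀ u c → Dec (OutRel u c)
  outRel? u c = any? (λ v → ¬? (v ≟ᶠ root) ×-dec ((parent v ≟ᶠ u) ×-dec (label v ≟ᶠ c)))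

  out : Fin n → Subset σ
  out u = Vec.tabulate (λ c → does (outRel? u c))

  -- co-lexicographic order: compare λ(u) λ(π u) λ(π² u) … lexicographically
  -- (the root-to-node strings read right to left; π(root)=root pads with #)
  _<colex_ : Fin n → Fin n → Set
  u <colex v = ∃ λ j → (∀ i → i Data.Nat.< j → label (anc parent i u) ≡ label (anc parent i v))
                      × (label (anc parent j u) Fin.< label (anc parent j v))

  -- ord i = the (i+1)-th node in co-lex order, provided ord is strictly increasing
  ColexSorted : (Fin n → Fin n) → Set
  ColexSorted ord = ∀ i j → i Fin.< j → ord i <colex ord j

  ctx : (k : ℕ) → Fin n → Vec (Fin σ) k
  ctx zero    u = []
  ctx (suc k) u = ctx k (parent u) ∷ʳ label u

  module _ (ord : Fin n → Fin n) where

    RunBreak : Fin n × Fin σ → Set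
    RunBreak (i , c) = (c ∈ out (ord i)) ×
                       (∀ j → toℕ j ≡ suc (toℕ i) → c ∉ out (ord j))

    runBreak? : ∀ p → Dec (RunBreak p)
    runBreak? (i , c) = (c ∈? out (ord i)) ×-dec
                        all? (λ j → (toℕ j ≟ suc (toℕ i)) →-dec ¬? (c ∈? out (ord j)))

    runs : ℕ
    runs = length (filter runBreak? (cartesianProduct (allFin n) (allFin σ)))

  cover : (Fin n → Fin n) → (k : ℕ) → Vec (Fin σ) k → List (Subset σ)
  cover ord k ρ = map (λ i → out (ord i))
                      (filter (λ i → ≡-dec _≟ᶠ_ (ctx k (ord i)) ρ) (allFin n))

-- 2 ^ H^wc(X) = ∏_c binom(n', n'_c)   (exponential form of the zero-order worst-case entropy)
expHwc : ∀ {σ} → List (Subset σ) → ℕ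
expHwc {σ} X = product (map (λ c → length X C length (filter (c ∈?_) X)) (allFin σ))

allStrings : (σ k : ℕ) → List (Vec (Fin σ) k)
allStrings σ zero    = List.[ [] ]
allStrings σ (suc k) = List.concatMap (λ c → map (c ∷_) (allStrings σ k)) (allFin σ)

-- 2 ^ H^wc_k(T) = ∏_ρ 2 ^ H^wc(cover ρ)
expHwcK : ∀ {σ n} → Trie σ n → (Fin n → Fin n) → ℕ → ℕ
expHwcK {σ} T ord k = product (map (λ ρ → expHwc (cover T ord k ρ)) (allStrings σ k))

{-# OPTIONS --safe #-}
-- Each c-run break i ends a maximal c-run of the sequence out(u_1), …, out(u_n).
-- Nodes with equal context π_k form an interval of the co-lex order, since π_k[u]
-- is the length-k prefix of the co-lex key of u; hence i also ends a c-run inside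
-- cover(π_k[u_i]).  A 0/1 sequence of length m with t ones and e run ends has
-- 2^e ≤ 2·C(m,t): reading it from the front, every run end "10" trades C(m,t)
-- for C(m+2,t+1) ≥ 2·C(m,t).  Over σ characters and σ^k contexts the factors 2
-- multiply to 2^(σ^(k+1)).
module Submission where

open import Defs
open import Data.Nat using (ℕ; suc; _+_; _*_; _^_; _≤_)
open import Data.Fin using (Fin)

open import Data.Bool.Base using (true; false; if_then_else_)
open import Data.Fin as Fin using (toℕ; zero; suc; inject₁)
import Data.Fin.Properties as Finₚ
open import Data.Fin.Subset using (Subset) renaming (_∈_ to _∈ˢ_)
open import Data.Fin.Subset.Properties using (_∈?_)
open import Data.List.Base using (List; []; _∷_; _++_; length; map; filter; tabulate; allFin;
  cartesianProduct; concatMap)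
open import Data.List.Membership.Propositional using (_∈_)
open import Data.List.Membership.Propositional.Properties using (∈-map⁺; ∈-concat⁺′; ∈-allFin)
open import Data.List.Properties using (map-++; map-∘; map-cong; length-++; length-map;
  length-tabulate; filter-accept; filter-none)
open import Data.List.Relation.Unary.All as All using (All; []; _∷_)
open import Data.List.Relation.Unary.AllPairs using (AllPairs; []; _∷_)
open import Data.List.Relation.Unary.Any using (here; there)
open import Data.List.Relation.Unary.Linked as Linked using (Linked; []; [-]; _∷_)
open import Data.List.Relation.Unary.Linked.Properties using (Linked⇒AllPairs)
open import Data.Nat.Base as ℕ using (zero; z≤n; s≤s)
open import Data.Nat.Combinatorics using (_C_; nCk+nC[k+1]≡[n+1]C[k+1])
open import Data.Nat.ListAction using (sum; product)
open import Data.Nat.ListAction.Properties using (sum-++)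
open import Data.Nat.Properties
open import Algebra.Properties.CommutativeSemigroup +-commutativeSemigroup
  using (interchange; x∙yz≈y∙xz)
open import Data.Product.Base using (∃; _×_; _,_; proj₁)
open import Data.Vec.Base using (Vec; []; _∷_; _∷ʳ_)
open import Data.Vec.Properties using (≡-dec; ∷ʳ-injectiveˡ; ∷ʳ-injectiveʳ)
open import Function.Base using (_∘_; id)
open import Relation.Binary.Core using (Rel)
open import Relation.Binary.Definitions using (DecidableEquality; Irreflexive; Transitive;
  tri<; tri≈; tri>)
open import Relation.Binary.PropositionalEquality
open import Relation.Nullary using (Dec; yes; no; does; ¬_; contradiction)
open import Relation.Nullary.Decidable using (_×-dec_; ¬?)
open import Relation.Unary using (Pred; Decidable)

𝟙 : ∀ {p} {P : Set p} → Dec P → ℕ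
𝟙 P? = if does P? then 1 else 0

𝟙-mono : ∀ {p q} {P : Set p} {Q : Set q} → (P → Q) → (P? : Dec P) (Q? : Dec Q) → 𝟙 P? ≤ 𝟙 Q?
𝟙-mono P⇒Q (yes p) (yes _) = ≤-refl
𝟙-mono P⇒Q (yes p) (no ¬q) = contradiction (P⇒Q p) ¬q
𝟙-mono P⇒Q (no _)  _       = z≤n

module _ {a} {A : Set a} where

  length-filter≡sum-𝟙 : ∀ {p} {P : Pred A p} (P? : Decidable P) xs →
                        length (filter P? xs) ≡ sum (map (𝟙 ∘ P?) xs)
  length-filter≡sum-𝟙 P? []       = refl
  length-filter≡sum-𝟙 P? (x ∷ xs) with does (P? x)
  ... | true  = cong suc (length-filter≡sum-𝟙 P? xs)
  ... | false = length-filter≡sum-𝟙 P? xs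

  sum-map-+ : ∀ (f g : A → ℕ) xs → sum (map (λ x → f x + g x) xs) ≡ sum (map f xs) + sum (map g xs)
  sum-map-+ f g []       = refl
  sum-map-+ f g (x ∷ xs) =
    trans (cong (f x + g x +_) (sum-map-+ f g xs)) (interchange (f x) (g x) _ _)

  sum-map-mono : ∀ {f g : A → ℕ} → (∀ x → f x ≤ g x) → ∀ xs → sum (map f xs) ≤ sum (map g xs)
  sum-map-mono f≤g []       = z≤n
  sum-map-mono f≤g (x ∷ xs) = +-mono-≤ (f≤g x) (sum-map-mono f≤g xs)

  sum-map-mono-absorbing : ∀ {f g : A → ℕ} {m x xs} → x ∈ xs → (∀ y → f y ≤ g y) →
                           m + f x ≤ g x → m + sum (map f xs) ≤ sum (map g xs)
  sum-map-mono-absorbing {f} {g} {m} {xs = x ∷ xs} (here refl) f≤g m+fx≤gx = begin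
    m + (f x + sum (map f xs)) ≡⟨ +-assoc m (f x) _ ⟨
    m + f x + sum (map f xs)   ≤⟨ +-mono-≤ m+fx≤gx (sum-map-mono f≤g xs) ⟩
    g x + sum (map g xs)       ∎
    where open ≤-Reasoning
  sum-map-mono-absorbing {f} {g} {m} {xs = y ∷ xs} (there x∈xs) f≤g m+fx≤gx = begin
    m + (f y + sum (map f xs)) ≡⟨ x∙yz≈y∙xz m (f y) _ ⟩
    f y + (m + sum (map f xs)) ≤⟨ +-mono-≤ (f≤g y) (sum-map-mono-absorbing x∈xs f≤g m+fx≤gx) ⟩
    g y + sum (map g xs)       ∎
    where open ≤-Reasoning

  ^-sum-map-≤ : ∀ {b m} {f g : A → ℕ} → (∀ x → b ^ f x ≤ m * g x) → ∀ xs →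
                b ^ sum (map f xs) ≤ m ^ length xs * product (map g xs)
  ^-sum-map-≤                 bound []       = ≤-refl
  ^-sum-map-≤ {b} {m} {f} {g} bound (x ∷ xs) = begin
    b ^ (f x + sum (map f xs))                      ≡⟨ ^-distribˡ-+-* b (f x) _ ⟩
    b ^ f x * b ^ sum (map f xs)                    ≤⟨ *-mono-≤ (bound x) (^-sum-map-≤ bound xs) ⟩
    m * g x * (m ^ length xs * product (map g xs))  ≡⟨ [m*n]*[o*p]≡[m*o]*[n*p] m (g x) _ _ ⟩
    m * m ^ length xs * (g x * product (map g xs))  ∎
    where open ≤-Reasoning

module _ {a b} {A : Set a} {B : Set b} where

  sum-map-cartesianProduct : ∀ (h : A × B → ℕ) (xs : List A) (ys : List B) →
    sum (map h (cartesianProduct xs ys)) ≡ sum (map (λ x → sum (map (λ y → h (x , y)) ys)) xs)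
  sum-map-cartesianProduct h []       ys = refl
  sum-map-cartesianProduct h (x ∷ xs) ys = begin
    sum (map h (map (x ,_) ys ++ cartesianProduct xs ys))
      ≡⟨ cong sum (map-++ h (map (x ,_) ys) _) ⟩
    sum (map h (map (x ,_) ys) ++ map h (cartesianProduct xs ys))
      ≡⟨ sum-++ (map h (map (x ,_) ys)) _ ⟩
    sum (map h (map (x ,_) ys)) + sum (map h (cartesianProduct xs ys))
      ≡⟨ cong₂ _+_ (sym (cong sum (map-∘ ys))) (sum-map-cartesianProduct h xs ys) ⟩
    sum (map (λ y → h (x , y)) ys) + sum (map (λ x → sum (map (λ y → h (x , y)) ys)) xs) ∎
    where open ≡-Reasoning

  sum-map-comm : ∀ (f : A → B → ℕ) (xs : List A) (ys : List B) →
    sum (map (λ x → sum (map (f x) ys)) xs) ≡ sum (map (λ y → sum (map (λ x → f x y) xs)) ys)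
  sum-map-comm f []       ys = sym (sum-map-zero ys)
    where
    sum-map-zero : ∀ ys → sum (map (λ (_ : B) → 0) ys) ≡ 0
    sum-map-zero []       = refl
    sum-map-zero (_ ∷ ys) = sum-map-zero ys
  sum-map-comm f (x ∷ xs) ys =
    trans (cong (sum (map (f x) ys) +_) (sum-map-comm f xs ys))
          (sym (sum-map-+ (f x) (λ y → sum (map (λ x → f x y) xs)) ys))

nCk≤[1+n]Ck : ∀ n k → n C k ≤ suc n C k
nCk≤[1+n]Ck n zero    = ≤-refl
nCk≤[1+n]Ck n (suc k) = ≤-trans (m≤n+m (n C suc k) (n C k)) (≤-reflexive (nCk+nC[k+1]≡[n+1]C[k+1] n k))

nCk≤[1+n]C[1+k] : ∀ n k → n C k ≤ suc n C suc k
nCk≤[1+n]C[1+k] n k = ≤-trans (m≤m+n (n C k) _) (≤-reflexive (nCk+nC[k+1]≡[n+1]C[k+1] n k))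

2*nCk≤[2+n]C[1+k] : ∀ n k → 2 * (n C k) ≤ suc (suc n) C suc k
2*nCk≤[2+n]C[1+k] n k = begin
  2 * (n C k)                 ≡⟨ cong (n C k +_) (+-identityʳ (n C k)) ⟩
  n C k + n C k               ≤⟨ +-mono-≤ (nCk≤[1+n]Ck n k) (nCk≤[1+n]C[1+k] n k) ⟩
  suc n C k + suc n C suc k   ≡⟨ nCk+nC[k+1]≡[n+1]C[k+1] (suc n) k ⟩
  suc (suc n) C suc k         ∎
  where open ≤-Reasoning

module _ {a p} {A : Set a} {P : Pred A p} (P? : Decidable P) where

  count : List A → ℕ
  count xs = length (filter P? xs)

  endsRun : A → List A → ℕ
  endsRun x []      = 𝟙 (P? x)
  endsRun x (y ∷ _) = 𝟙 (P? x ×-dec ¬? (P? y))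

  runEnds : List A → ℕ
  runEnds []       = 0
  runEnds (x ∷ xs) = endsRun x xs + runEnds xs

  endsRun-¬ : ∀ {x} → ¬ P x → ∀ xs → endsRun x xs ≡ 0
  endsRun-¬ {x} ¬px []      with P? x
  ... | yes px = contradiction px ¬px
  ... | no  _  = refl
  endsRun-¬ {x} ¬px (_ ∷ _) with P? x
  ... | yes px = contradiction px ¬px
  ... | no  _  = refl

  2^runEnds≤2*C : ∀ xs → 2 ^ runEnds xs ≤ 2 * (length xs C count xs)
  2^runEnds≤2*C []           = s≤s z≤n
  2^runEnds≤2*C (x ∷ [])     with P? x
  ... | yes _ = ≤-refl
  ... | no  _ = s≤s z≤n
  2^runEnds≤2*C (x ∷ y ∷ xs) with P? x | 2^runEnds≤2*C (y ∷ xs) | 2^runEnds≤2*C xs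
  ... | no  _ | ih[y∷xs] | _ =
    ≤-trans ih[y∷xs] (*-monoʳ-≤ 2 (nCk≤[1+n]Ck (suc (length xs)) (count (y ∷ xs))))
  ... | yes _ | ih[y∷xs] | ih[xs] with P? y | ih[y∷xs]
  ...   | yes _  | ih[y∷xs]′ =
    ≤-trans ih[y∷xs]′ (*-monoʳ-≤ 2 (nCk≤[1+n]C[1+k] (suc (length xs)) (suc (count xs))))
  ...   | no ¬py | _ rewrite endsRun-¬ ¬py xs =
    ≤-trans (*-monoʳ-≤ 2 ih[xs]) (*-monoʳ-≤ 2 (2*nCk≤[2+n]C[1+k] (length xs) (count xs)))

runEnds-map : ∀ {a b p} {A : Set a} {B : Set b} {P : Pred B p} (P? : Decidable P) (f : A → B) xs →
              runEnds P? (map f xs) ≡ runEnds (P? ∘ f) xs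
runEnds-map P? f []           = refl
runEnds-map P? f (x ∷ [])     = refl
runEnds-map P? f (x ∷ y ∷ xs) = cong (𝟙 (P? (f x) ×-dec ¬? (P? (f y))) +_) (runEnds-map P? f (y ∷ xs))

module _ {a r p} {A : Set a} (_⋖_ : Rel A r) {P : Pred A p} (P? : Decidable P) where

  EndsRunAt : Pred A _
  EndsRunAt x = P x × (∀ y → x ⋖ y → ¬ P y)

  sum-𝟙-EndsRunAt≤runEnds : (E? : Decidable EndsRunAt) → ∀ {xs} → Linked _⋖_ xs →
                            sum (map (𝟙 ∘ E?) xs) ≤ runEnds P? xs
  sum-𝟙-EndsRunAt≤runEnds E? []                  = z≤n
  sum-𝟙-EndsRunAt≤runEnds E? {x ∷ []} [-]        = +-monoˡ-≤ 0 (𝟙-mono proj₁ (E? x) (P? x))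
  sum-𝟙-EndsRunAt≤runEnds E? {x ∷ y ∷ _} (x⋖y ∷ linked) =
    +-mono-≤ (𝟙-mono (λ (px , ends) → px , ends y x⋖y) (E? x) (P? x ×-dec ¬? (P? y)))
             (sum-𝟙-EndsRunAt≤runEnds E? linked)

module _ {a k} {A : Set a} {K : Set k} (_≟_ : DecidableEquality K) (g : A → K) where

  class : K → List A → List A
  class ρ = filter (λ x → g x ≟ ρ)

  runEnds-class-∷ : ∀ {p} {P : Pred A p} (P? : Decidable P) ρ x xs →
                    runEnds P? (class ρ xs) ≤ runEnds P? (class ρ (x ∷ xs))
  runEnds-class-∷ P? ρ x xs with g x ≟ ρ
  ... | yes _ = m≤n+m _ _
  ... | no  _ = ≤-refl

  module _ {ℓ} {_<_ : Rel A ℓ} (convex : ∀ {x y z} → x < y → y < z → g x ≡ g z → g y ≡ g x) where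

    class-≡[]-past-boundary : ∀ {x y ys} → x < y → All (y <_) ys → g y ≢ g x → class (g x) ys ≡ []
    class-≡[]-past-boundary x<y y<ys gy≢gx =
      filter-none _ (All.map (λ y<z gz≡gx → gy≢gx (convex x<y y<z (sym gz≡gx))) y<ys)

    module _ {p} {P : Pred A p} (P? : Decidable P) where

      endsRun≤endsRun-class : ∀ {x xs} → All (x <_) xs → AllPairs _<_ xs →
                              endsRun P? x xs ≤ endsRun P? x (class (g x) xs)
      endsRun≤endsRun-class {x} {[]}     _         _          = ≤-refl
      endsRun≤endsRun-class {x} {y ∷ ys} (x<y ∷ _) (y<ys ∷ _) with g y ≟ g x
      ... | yes _    = ≤-refl
      ... | no gy≢gx rewrite class-≡[]-past-boundary x<y y<ys gy≢gx =
        𝟙-mono proj₁ (P? x ×-dec ¬? (P? y)) (P? x)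

      runEnds≤sum-runEnds-class : ∀ {xs} → AllPairs _<_ xs → (ρs : List K) → (∀ x → g x ∈ ρs) →
                                  runEnds P? xs ≤ sum (map (λ ρ → runEnds P? (class ρ xs)) ρs)
      runEnds≤sum-runEnds-class {[]}     _               ρs complete = z≤n
      runEnds≤sum-runEnds-class {x ∷ xs} (x<xs ∷ sorted) ρs complete =
        ≤-trans (+-monoʳ-≤ (endsRun P? x xs) (runEnds≤sum-runEnds-class sorted ρs complete))
                (sum-map-mono-absorbing (complete x) (λ ρ → runEnds-class-∷ P? ρ x xs) own-class)
        where
        own-class : endsRun P? x xs + runEnds P? (class (g x) xs) ≤ runEnds P? (class (g x) (x ∷ xs))
        own-class rewrite filter-accept (λ z → g z ≟ g x) {x} {xs} refl =
          +-monoˡ-≤ _ (endsRun≤endsRun-class x<xs sorted)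

module _ {a} {A : Set a} where

  AgreeBelow : ℕ → (ℕ → A) → (ℕ → A) → Set a
  AgreeBelow k α β = ∀ i → i ℕ.< k → α i ≡ β i

module _ {a ℓ} {A : Set a} {_<_ : Rel A ℓ} where

  _<lex_ : (ℕ → A) → (ℕ → A) → Set _
  α <lex β = ∃ λ j → AgreeBelow j α β × (α j < β j)

  <lex-convex : Irreflexive _≡_ _<_ → Transitive _<_ → ∀ {k α β γ} →
                α <lex β → β <lex γ → AgreeBelow k α γ → AgreeBelow k α β
  <lex-convex irrefl transitive {k} {α} {β} {γ} (p , α≈β , αp<βp) (q , β≈γ , βq<γq) α≈γ i i<k =
    α≈β i (<-≤-trans i<k (≮⇒≥ p≮k))
    where
    p≮k : ¬ p ℕ.< k
    p≮k p<k with <-cmp p q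
    ... | tri< p<q _ _  = irrefl (trans (α≈γ p p<k) (sym (β≈γ p p<q))) αp<βp
    ... | tri≈ _ refl _ = irrefl (α≈γ p p<k) (transitive αp<βp βq<γq)
    ... | tri> _ _ q<p  = irrefl (trans (sym (α≈β q q<p)) (α≈γ q (<-trans q<p p<k))) βq<γq

Linked-tabulate⁺ : ∀ {a r} {A : Set a} {R : Rel A r} {n} (f : Fin (suc n) → A) →
                   (∀ i → R (f (inject₁ i)) (f (suc i))) → Linked R (tabulate f)
Linked-tabulate⁺ {n = zero}  f _      = [-]
Linked-tabulate⁺ {n = suc n} f R-step = R-step zero ∷ Linked-tabulate⁺ (f ∘ suc) (R-step ∘ suc)

allFin-consecutive : ∀ n → Linked (λ i j → toℕ j ≡ suc (toℕ i)) (allFin n)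
allFin-consecutive zero    = []
allFin-consecutive (suc n) = Linked-tabulate⁺ id (λ i → cong suc (sym (Finₚ.toℕ-inject₁ i)))

allFin-sorted : ∀ n → AllPairs Fin._<_ (allFin n)
allFin-sorted n = Linked⇒AllPairs Finₚ.<-trans (Linked.map (≤-reflexive ∘ sym) (allFin-consecutive n))

length-allStrings : ∀ σ k → length (allStrings σ k) ≡ σ ^ k
length-allStrings σ zero    = refl
length-allStrings σ (suc k) =
  trans (length-concatMap (allFin σ)) (cong₂ _*_ (length-tabulate {n = σ} id) (length-allStrings σ k))
  where
  length-concatMap : ∀ cs → length (concatMap (λ c → map (c ∷_) (allStrings σ k)) cs)
                            ≡ length cs * length (allStrings σ k)
  length-concatMap []       = refl
  length-concatMap (c ∷ cs) =
    trans (length-++ (map (c ∷_) (allStrings σ k)))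
          (cong₂ _+_ (length-map (c ∷_) (allStrings σ k)) (length-concatMap cs))

∈-allStrings : ∀ σ k (ρ : Vec (Fin σ) k) → ρ ∈ allStrings σ k
∈-allStrings σ zero    []      = here refl
∈-allStrings σ (suc k) (c ∷ ρ) =
  ∈-concat⁺′ (∈-map⁺ (c ∷_) (∈-allStrings σ k ρ))
             (∈-map⁺ (λ c → map (c ∷_) (allStrings σ k)) (∈-allFin c))

totalRuns : ∀ {σ} → List (Subset σ) → ℕ
totalRuns {σ} X = sum (map (λ c → runEnds (c ∈?_) X) (allFin σ))

2^totalRuns≤2^σ*expHwc : ∀ {σ} (X : List (Subset σ)) → 2 ^ totalRuns X ≤ 2 ^ σ * expHwc X
2^totalRuns≤2^σ*expHwc {σ} X =
  ≤-trans (^-sum-map-≤ {m = 2} {g = λ c → length X C count (c ∈?_) X}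
                       (λ c → 2^runEnds≤2*C (c ∈?_) X) (allFin σ))
          (≤-reflexive (cong (λ m → 2 ^ m * expHwc X) (length-tabulate {n = σ} id)))

module _ {σ n} (T : Trie σ n) where
  open Trie T

  labels : Fin n → ℕ → Fin σ
  labels u t = label (anc parent t u)

  AgreeBelow⇒ctx≡ : ∀ k {u v} → AgreeBelow k (labels u) (labels v) → ctx T k u ≡ ctx T k v
  AgreeBelow⇒ctx≡ zero    _     = refl
  AgreeBelow⇒ctx≡ (suc k) agree =
    cong₂ _∷ʳ_ (AgreeBelow⇒ctx≡ k (λ t t<k → agree (suc t) (s≤s t<k))) (agree 0 (s≤s z≤n))

  ctx≡⇒AgreeBelow : ∀ k {u v} → ctx T k u ≡ ctx T k v → AgreeBelow k (labels u) (labels v)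
  ctx≡⇒AgreeBelow (suc k) {u} {v} eq zero    _         = ∷ʳ-injectiveʳ (ctx T k (parent u)) _ eq
  ctx≡⇒AgreeBelow (suc k) {u} {v} eq (suc t) (s≤s t<k) =
    ctx≡⇒AgreeBelow k (∷ʳ-injectiveˡ (ctx T k (parent u)) _ eq) t t<k

  module _ {ord : Fin n → Fin n} (sorted : ColexSorted T ord) (k : ℕ) where

    context : Fin n → Vec (Fin σ) k
    context i = ctx T k (ord i)

    context-convex : ∀ {i j l} → i Fin.< j → j Fin.< l → context i ≡ context l → context j ≡ context i
    context-convex {i} {j} {l} i<j j<l eq = sym (AgreeBelow⇒ctx≡ k
      (<lex-convex Finₚ.<-irrefl Finₚ.<-trans (sorted i j i<j) (sorted j l j<l) (ctx≡⇒AgreeBelow k eq)))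

    -- RunBreak (i , c) unfolds to EndsRunAt for the successor relation on allFin n
    -- and the predicate c ∈ out (ord i).
    runs≤sum-totalRuns-cover : runs T ord ≤ sum (map (λ ρ → totalRuns (cover T ord k ρ)) (allStrings σ k))
    runs≤sum-totalRuns-cover = begin
      runs T ord
        ≡⟨ length-filter≡sum-𝟙 (runBreak? T ord) (cartesianProduct (allFin n) (allFin σ)) ⟩
      sum (map (𝟙 ∘ runBreak? T ord) (cartesianProduct (allFin n) (allFin σ)))
        ≡⟨ sum-map-cartesianProduct (𝟙 ∘ runBreak? T ord) (allFin n) (allFin σ) ⟩
      sum (map (λ i → sum (map (λ c → runBreaks c i) (allFin σ))) (allFin n))
        ≡⟨ sum-map-comm (λ i c → runBreaks c i) (allFin n) (allFin σ) ⟩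
      sum (map (λ c → sum (map (runBreaks c) (allFin n))) (allFin σ))
        ≤⟨ sum-map-mono (λ c → sum-𝟙-EndsRunAt≤runEnds _ (c∈out? c) (λ i → runBreak? T ord (i , c))
                                                        (allFin-consecutive n))
                        (allFin σ) ⟩
      sum (map (λ c → runEnds (c∈out? c) (allFin n)) (allFin σ))
        ≤⟨ sum-map-mono (λ c → runEnds≤sum-runEnds-class (≡-dec Finₚ._≟_) context context-convex
                                 (c∈out? c) (allFin-sorted n) ρs (λ i → ∈-allStrings σ k (context i)))
                        (allFin σ) ⟩
      sum (map (λ c → sum (map (λ ρ → runEnds (c∈out? c) (classOf ρ)) ρs)) (allFin σ))
        ≡⟨ sum-map-comm (λ c ρ → runEnds (c∈out? c) (classOf ρ)) (allFin σ) ρs ⟩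
      sum (map (λ ρ → sum (map (λ c → runEnds (c∈out? c) (classOf ρ)) (allFin σ))) ρs)
        ≡⟨ cong sum (map-cong (λ ρ → cong sum (map-cong (λ c →
             runEnds-map (c ∈?_) (out T ∘ ord) (classOf ρ)) (allFin σ))) ρs) ⟨
      sum (map (λ ρ → totalRuns (cover T ord k ρ)) ρs) ∎
      where
      open ≤-Reasoning
      ρs : List (Vec (Fin σ) k)
      ρs = allStrings σ k
      runBreaks : Fin σ → Fin n → ℕ
      runBreaks c i = 𝟙 (runBreak? T ord (i , c))
      c∈out? : (c : Fin σ) → Decidable (λ i → c ∈ˢ out T (ord i))
      c∈out? c i = c ∈? out T (ord i)
      classOf : Vec (Fin σ) k → List (Fin n)
      classOf ρ = class (≡-dec Finₚ._≟_) context ρ (allFin n)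

theorem1 : ∀ {σ n} (T : Trie σ n) (ord : Fin n → Fin n) → ColexSorted T ord →
           (k : ℕ) → 2 ^ runs T ord ≤ 2 ^ (σ ^ (k + 1)) * expHwcK T ord k
theorem1 {σ} T ord sorted k = begin
  2 ^ runs T ord                                ≤⟨ ^-monoʳ-≤ 2 (runs≤sum-totalRuns-cover T sorted k) ⟩
  2 ^ sum (map (λ ρ → totalRuns (cover T ord k ρ)) (allStrings σ k))
    ≤⟨ ^-sum-map-≤ (λ ρ → 2^totalRuns≤2^σ*expHwc (cover T ord k ρ)) (allStrings σ k) ⟩
  (2 ^ σ) ^ length (allStrings σ k) * expHwcK T ord k
    ≡⟨ cong (λ e → (2 ^ σ) ^ e * expHwcK T ord k) (length-allStrings σ k) ⟩
  (2 ^ σ) ^ σ ^ k * expHwcK T ord k             ≡⟨ cong (_* expHwcK T ord k) (^-*-assoc 2 σ (σ ^ k)) ⟩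
  2 ^ (σ ^ suc k) * expHwcK T ord k             ≡⟨ cong (λ e → 2 ^ (σ ^ e) * expHwcK T ord k) (+-comm 1 k) ⟩
  2 ^ (σ ^ (k + 1)) * expHwcK T ord k           ∎
  where open ≤-Reasoning
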